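{- For $n\ge 3$ and $0\le i\le 2n-1$, $$T_{n,i}(x;q)=q^{\chi(i\ge n)}\Big(x\sum_{j=0}^{\lceil\frac{n-1}{n}i\rceil-1}T_{n-1,j}(x;q)+\sum_{j=\lceil\frac{n-1}{n}i\rceil}^{2n-3}T_{n-1,j}(x;q)\Big),$$ and the initial values are $T_{2,0}(x;q)=1+q$, $T_{2,1}(x;q)=(1+q)x$, $T_{2,2}(x;q)=(q+q^2)x$, $T_{2,3}(x;q)=(q+q^2)x^2$. In particular, $T_{n,0}(x;q)=T_{n-1}(x;q)$ for $n\ge 3$.
   Context: $I_n$ is the set of integer sequences $\mathbf e=(e_1,\dots,e_n)$ with $0\le e_i<2i$ for all $i$. For $\mathbf e\in I_n$: $\operatorname{exc}\mathbf e=\#\{i: e_i\ge i\}$; $\operatorname{Asc}_D\mathbf e=\{i\in[n-1]: e_i/i<e_{i+1}/(i+1)\}\cup\{0:\text{if } e_1+e_2/2\ge3/2\}$, $\operatorname{asc}_D\mathbf e=|\operatorname{Asc}_D\mathbf e|$. $\chi(\varphi)$ is $1$ if $\varphi$ is true and $0$ otherwise. Define $T_{n,i}(x;q)=\sum_{\mathbf e\in I_n}\chi(e_n=i)\,q^{\operatorname{exc}\mathbf e}x^{\operatorname{asc}_D\mathbf e}$ for $0\le i\le 2n-1$, and $T_n(x;q)=\sum_{i=0}^{2n-1}T_{n,i}(x;q)=\sum_{\mathbf e\in I_n}q^{\operatorname{exc}\mathbf e}x^{\operatorname{asc}_D\mathbf e}$. -}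

module Defs where

open import Data.Nat using (ℕ; zero; suc; _+_; _*_; _∸_; _/_; _≤_; _<_; _≤?_; _<?_; _≟_)
open import Data.Bool using (Bool; true; false; _∧_)
open import Data.List using (List; []; _∷_; map; concatMap; upTo; _++_; [_])
open import Data.Nat.ListAction using (sum)
open import Relation.Nullary.Decidable using (⌊_⌋)
open import Relation.Binary.PropositionalEquality using (_≡_)

χ : Bool → ℕ
χ true  = 1
χ false = 0

-- I n : all sequences (e_1,…,e_n) with 0 ≤ e_i < 2i, as lists with e_1 first
I : ℕ → List (List ℕ)
I zero    = [] ∷ []
I (suc n) = concatMap (λ e → map (λ k → e ++ [ k ]) (upTo (2 * suc n))) (I n)

-- last entry e_n (default 0 for the empty sequence; only used for n ≥ 1)
lastOr0 : List ℕ → ℕ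
lastOr0 []           = 0
lastOr0 (a ∷ [])     = a
lastOr0 (_ ∷ b ∷ bs) = lastOr0 (b ∷ bs)

excFrom : ℕ → List ℕ → ℕ
excFrom k []       = 0
excFrom k (a ∷ es) = χ ⌊ k ≤? a ⌋ + excFrom (suc k) es

exc : List ℕ → ℕ
exc = excFrom 1

-- #{ i ∈ [n-1] : e_i / i < e_{i+1} / (i+1) }, i.e. e_i (i+1) < e_{i+1} i
ascFrom : ℕ → List ℕ → ℕ
ascFrom k []           = 0
ascFrom k (a ∷ [])     = 0
ascFrom k (a ∷ b ∷ es) = χ ⌊ a * suc k <? b * k ⌋ + ascFrom (suc k) (b ∷ es)

-- 0 ∈ Asc_D e iff e_1 + e_2/2 ≥ 3/2, i.e. 2 e_1 + e_2 ≥ 3 (only meaningful for n ≥ 2)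
asc0 : List ℕ → ℕ
asc0 (a ∷ b ∷ _) = χ ⌊ 3 ≤? 2 * a + b ⌋
asc0 _           = 0

ascD : List ℕ → ℕ
ascD e = asc0 e + ascFrom 1 e

-- Bivariate polynomials in q, x with ℕ coefficients, represented by their
-- coefficient function: p a b = coefficient of q^a x^b.
Poly : Set
Poly = ℕ → ℕ → ℕ

_≐_ : Poly → Poly → Set
p ≐ r = ∀ a b → p a b ≡ r a b

infixl 6 _⊕_
_⊕_ : Poly → Poly → Poly
(p ⊕ r) a b = p a b + r a b

0P : Poly
0P _ _ = 0

mono : ℕ → ℕ → Poly
mono i j a b = χ (⌊ a ≟ i ⌋ ∧ ⌊ b ≟ j ⌋)

mulX : Poly → Poly
mulX p a zero    = 0
mulX p a (suc b) = p a b

mulQ : Poly → Poly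
mulQ p zero    b = 0
mulQ p (suc a) b = p a b

mulQif : Bool → Poly → Poly
mulQif true  p = mulQ p
mulQif false p = p

ΣP : ℕ → ℕ → (ℕ → Poly) → Poly
ΣP lo zero    f = 0P
ΣP lo (suc m) f = f lo ⊕ ΣP (suc lo) m f

T : ℕ → ℕ → Poly
T n i a b = sum (map (λ e → χ (⌊ lastOr0 e ≟ i ⌋ ∧ ⌊ exc e ≟ a ⌋ ∧ ⌊ ascD e ≟ b ⌋)) (I n))

Tall : ℕ → Poly
Tall n a b = sum (map (λ e → χ (⌊ exc e ≟ a ⌋ ∧ ⌊ ascD e ≟ b ⌋)) (I n))

ceilDiv : ℕ → ℕ → ℕ
ceilDiv m zero    = 0
ceilDiv m (suc k) = (m + k) / suc k

-- Appending a last entry i to e ∈ I_{n-1} multiplies the weight q^exc x^asc_D by q exactly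
-- when i ≥ n and by x exactly when e_{n-1}/(n-1) < i/n; the ascent at position 0 only sees
-- e_1 and e_2, so for n ≥ 3 it is unaffected. For fixed i, the ascent condition
-- e_{n-1} n < i (n-1) says e_{n-1} < ⌈(n-1)i/n⌉, so summing over the possible values of
-- e_{n-1} splits Σ_j T_{n-1,j} at that threshold, the lower part acquiring a factor x.
module Submission where

open import Defs
open import Algebra.Properties.CommutativeSemigroup as CSemigroup using ()
open import Data.Bool using (Bool; true; false; _∧_)
open import Data.Bool.Properties using (∧-zeroʳ)
open import Data.List using (List; []; _∷_; _++_; [_]; map; concatMap; upTo; length)
open import Data.List.Properties using (map-++; map-cong; map-∘; length-++)
open import Data.List.Membership.Propositional using (_∈_)
open import Data.List.Membership.Propositional.Properties using (∈-upTo⁺)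
open import Data.List.Relation.Unary.All as All using (All; []; _∷_; universal)
open import Data.List.Relation.Unary.All.Properties using (map⁺; concat⁺; applyUpTo⁺₁)
open import Data.List.Relation.Unary.AllPairs using (_∷_)
open import Data.List.Relation.Unary.Any using (here; there)
open import Data.List.Relation.Unary.Unique.Propositional using (Unique)
open import Data.List.Relation.Unary.Unique.Propositional.Properties using (upTo⁺)
open import Data.Nat using (ℕ; zero; suc; _+_; _*_; _∸_; _≤_; _<_; _≤ᵇ_; _/_; z≤n; s≤s; z<s)
open import Data.Nat.DivMod using (m*n/n≡m; m/n*n≤m; /-monoˡ-≤)
open import Data.Nat.ListAction using (sum)
open import Data.Nat.ListAction.Properties using (sum-++)
open import Data.Nat.Properties
open import Data.Product using (_×_; _,_)
open import Data.Unit using (tt)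
open import Function.Bundles using (_⇔_; mk⇔)
open import Level using (0ℓ)
open import Relation.Binary.Bundles using (Setoid)
import Relation.Binary.Reasoning.Setoid as SetoidReasoning
open import Relation.Binary.PropositionalEquality hiding ([_])
open import Relation.Nullary.Decidable using (Dec; yes; no; ⌊_⌋; isYes≗does; does-⇔; dec-no)
open import Relation.Nullary.Negation using (contradiction)

open CSemigroup +-commutativeSemigroup using (interchange; x∙yz≈y∙xz)

⌊⌋-⇔ : ∀ {A B : Set} → A ⇔ B → (a? : Dec A) (b? : Dec B) → ⌊ a? ⌋ ≡ ⌊ b? ⌋
⌊⌋-⇔ A⇔B a? b? = trans (isYes≗does a?) (trans (does-⇔ A⇔B a? b?) (sym (isYes≗does b?)))

⌊≟⌋-refl : ∀ m → ⌊ m ≟ m ⌋ ≡ true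
⌊≟⌋-refl m = cong ⌊_⌋ (≟-diag refl)

⌊≟⌋-≢ : ∀ {m n} → m ≢ n → ⌊ m ≟ n ⌋ ≡ false
⌊≟⌋-≢ {m} {n} m≢n = cong ⌊_⌋ (dec-no (m ≟ n) m≢n)

⌊≟⌋-comm : ∀ m n → ⌊ m ≟ n ⌋ ≡ ⌊ n ≟ m ⌋
⌊≟⌋-comm m n = ⌊⌋-⇔ (mk⇔ sym sym) (m ≟ n) (n ≟ m)

⌊suc≟suc⌋ : ∀ m n → ⌊ suc m ≟ suc n ⌋ ≡ ⌊ m ≟ n ⌋
⌊suc≟suc⌋ m n = ⌊⌋-⇔ (mk⇔ suc-injective (cong suc)) (suc m ≟ suc n) (m ≟ n)

χ-∧ : ∀ x y → χ (x ∧ y) ≡ χ x * χ y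
χ-∧ true  y = sym (+-identityʳ (χ y))
χ-∧ false y = refl

<-ceilDiv-⇔ : ∀ j m d → j * suc d < m ⇔ j < ceilDiv m (suc d)
<-ceilDiv-⇔ j m d = mk⇔ to from
  where
  expand : suc j * suc d ≡ suc (j * suc d) + d
  expand = cong suc (+-comm d (j * suc d))

  to : j * suc d < m → suc j ≤ (m + d) / suc d
  to lt = begin
    suc j                     ≡⟨ m*n/n≡m (suc j) (suc d) ⟨
    suc j * suc d / suc d     ≤⟨ /-monoˡ-≤ (suc d) (≤-trans (≤-reflexive expand) (+-monoˡ-≤ d lt)) ⟩
    (m + d) / suc d           ∎
    where open ≤-Reasoning

  from : suc j ≤ (m + d) / suc d → suc (j * suc d) ≤ m
  from le = +-cancelʳ-≤ d _ _ (begin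
    suc (j * suc d) + d       ≡⟨ expand ⟨
    suc j * suc d             ≤⟨ *-monoˡ-≤ (suc d) le ⟩
    (m + d) / suc d * suc d   ≤⟨ m/n*n≤m (m + d) (suc d) ⟩
    m + d                     ∎)
    where open ≤-Reasoning

⌊<?⌋-ceilDiv : ∀ j m d → ⌊ j * suc d <? m ⌋ ≡ ⌊ j <? ceilDiv m (suc d) ⌋
⌊<?⌋-ceilDiv j m d = ⌊⌋-⇔ (<-ceilDiv-⇔ j m d) _ _

≐-refl : ∀ {p} → p ≐ p
≐-refl _ _ = refl

≐-reflexive : ∀ {p r} → p ≡ r → p ≐ r
≐-reflexive refl = ≐-refl

≐-sym : ∀ {p r} → p ≐ r → r ≐ p
≐-sym p≐r a b = sym (p≐r a b)

≐-trans : ∀ {p r s} → p ≐ r → r ≐ s → p ≐ s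
≐-trans p≐r r≐s a b = trans (p≐r a b) (r≐s a b)

≐-setoid : Setoid 0ℓ 0ℓ
≐-setoid = record
  { Carrier       = Poly
  ; _≈_           = _≐_
  ; isEquivalence = record { refl = ≐-refl ; sym = ≐-sym ; trans = ≐-trans }
  }

module ≐-Reasoning = SetoidReasoning ≐-setoid

⊕-cong : ∀ {p p′ r r′} → p ≐ p′ → r ≐ r′ → (p ⊕ r) ≐ (p′ ⊕ r′)
⊕-cong p≐p′ r≐r′ a b = cong₂ _+_ (p≐p′ a b) (r≐r′ a b)

mulX-cong : ∀ {p r} → p ≐ r → mulX p ≐ mulX r
mulX-cong p≐r a zero    = refl
mulX-cong p≐r a (suc b) = p≐r a b

mulQif-cong : ∀ β {p r} → p ≐ r → mulQif β p ≐ mulQif β r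
mulQif-cong true  p≐r zero    b = refl
mulQif-cong true  p≐r (suc a) b = p≐r a b
mulQif-cong false p≐r         = p≐r

mulXif : Bool → Poly → Poly
mulXif true  p = mulX p
mulXif false p = p

mono-≟-comm : ∀ s t a b → χ (⌊ s ≟ a ⌋ ∧ ⌊ t ≟ b ⌋) ≡ mono s t a b
mono-≟-comm s t a b = cong₂ (λ α β → χ (α ∧ β)) (⌊≟⌋-comm s a) (⌊≟⌋-comm t b)

mulQif-mono : ∀ β s t → mulQif β (mono s t) ≐ mono (χ β + s) t
mulQif-mono true  s t zero    b = refl
mulQif-mono true  s t (suc a) b = cong (λ α → χ (α ∧ ⌊ b ≟ t ⌋)) (sym (⌊suc≟suc⌋ a s))
mulQif-mono false s t         = ≐-refl

mulXif-mono : ∀ β s t → mulXif β (mono s t) ≐ mono s (χ β + t)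
mulXif-mono true  s t a zero    = sym (cong χ (∧-zeroʳ ⌊ a ≟ s ⌋))
mulXif-mono true  s t a (suc b) = cong (λ β → χ (⌊ a ≟ s ⌋ ∧ β)) (sym (⌊suc≟suc⌋ b t))
mulXif-mono false s t           = ≐-refl

infixr 25 _·_
_·_ : ℕ → Poly → Poly
(k · p) a b = k * p a b

·-distribʳ-+ : ∀ k l p → (k + l) · p ≐ (k · p ⊕ l · p)
·-distribʳ-+ k l p a b = *-distribʳ-+ (p a b) k l

-- The hypothesis is the normal form of T 2 i: exactly two sequences of I 2 end in i.
≐-two-monos : ∀ (p : Poly) s t s′ t′ →
  (∀ a b → p a b ≡ χ (⌊ s ≟ a ⌋ ∧ ⌊ t ≟ b ⌋)
                 + (χ (⌊ s′ ≟ a ⌋ ∧ ⌊ t′ ≟ b ⌋) + 0)) →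
  p ≐ (mono s t ⊕ mono s′ t′)
≐-two-monos p s t s′ t′ p≡ a b = trans (p≡ a b)
  (cong₂ _+_ (mono-≟-comm s t a b) (trans (+-identityʳ _) (mono-≟-comm s′ t′ a b)))

⨁ : {A : Set} → List A → (A → Poly) → Poly
⨁ xs f a b = sum (map (λ x → f x a b) xs)

module _ {A : Set} where

  ⨁-cong : ∀ {xs} {f g : A → Poly} → All (λ x → f x ≐ g x) xs → ⨁ xs f ≐ ⨁ xs g
  ⨁-cong []           a b = refl
  ⨁-cong (fx≐gx ∷ eqs) a b = cong₂ _+_ (fx≐gx a b) (⨁-cong eqs a b)

  ⨁-zero : ∀ {xs} {f : A → Poly} → All (λ x → f x ≐ 0P) xs → ⨁ xs f ≐ 0P
  ⨁-zero []             a b = refl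
  ⨁-zero (fx≐0 ∷ zeros) a b = cong₂ _+_ (fx≐0 a b) (⨁-zero zeros a b)

  ⨁-⊕ : ∀ xs (f g : A → Poly) → (⨁ xs f ⊕ ⨁ xs g) ≐ ⨁ xs (λ x → f x ⊕ g x)
  ⨁-⊕ []       f g a b = refl
  ⨁-⊕ (x ∷ xs) f g a b = trans (interchange (f x a b) _ (g x a b) _) (cong (_ +_) (⨁-⊕ xs f g a b))

  ⨁-++ : ∀ xs ys (f : A → Poly) → ⨁ (xs ++ ys) f ≐ (⨁ xs f ⊕ ⨁ ys f)
  ⨁-++ xs ys f a b = trans (cong sum (map-++ _ xs ys)) (sum-++ (map (λ x → f x a b) xs) _)

  ⨁-map : ∀ {B : Set} (h : B → A) ys (f : A → Poly) → ⨁ (map h ys) f ≐ ⨁ ys (λ y → f (h y))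
  ⨁-map h ys f a b = cong sum (sym (map-∘ {g = λ x → f x a b} {f = h} ys))

  ⨁-concatMap : ∀ {B : Set} (h : B → List A) ys (f : A → Poly) →
    ⨁ (concatMap h ys) f ≐ ⨁ ys (λ y → ⨁ (h y) f)
  ⨁-concatMap h []       f a b = refl
  ⨁-concatMap h (y ∷ ys) f a b =
    trans (⨁-++ (h y) (concatMap h ys) f a b) (cong (_ +_) (⨁-concatMap h ys f a b))

  ⨁-mulX : ∀ xs (f : A → Poly) → mulX (⨁ xs f) ≐ ⨁ xs (λ x → mulX (f x))
  ⨁-mulX []       f a zero    = refl
  ⨁-mulX (x ∷ xs) f a zero    = ⨁-mulX xs f a zero
  ⨁-mulX xs       f a (suc b) = refl

  ⨁-mulQif : ∀ β xs (f : A → Poly) → mulQif β (⨁ xs f) ≐ ⨁ xs (λ x → mulQif β (f x))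
  ⨁-mulQif true  []       f zero    b = refl
  ⨁-mulQif true  (x ∷ xs) f zero    b = ⨁-mulQif true xs f zero b
  ⨁-mulQif true  xs       f (suc a) b = refl
  ⨁-mulQif false xs       f           = ≐-refl

⨁-δ : ∀ {i xs} (p : ℕ → Poly) → Unique xs → i ∈ xs →
  ⨁ xs (λ k → χ ⌊ k ≟ i ⌋ · p k) ≐ p i
⨁-δ {i} {_ ∷ xs} p (i≢xs ∷ _) (here refl) a b = begin
  χ ⌊ i ≟ i ⌋ * p i a b + ⨁ xs (λ k → χ ⌊ k ≟ i ⌋ · p k) a b
    ≡⟨ cong₂ _+_ (cong (λ β → χ β * p i a b) (⌊≟⌋-refl i))
                 (⨁-zero (All.map off-diagonal i≢xs) a b) ⟩
  1 * p i a b + 0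
    ≡⟨ trans (+-identityʳ _) (*-identityˡ _) ⟩
  p i a b ∎
  where
  open ≡-Reasoning
  off-diagonal : ∀ {k} → i ≢ k → χ ⌊ k ≟ i ⌋ · p k ≐ 0P
  off-diagonal i≢k a b = cong (λ β → χ β * p _ a b) (⌊≟⌋-≢ (≢-sym i≢k))
⨁-δ {i} {x ∷ xs} p (x≢xs ∷ unique) (there i∈xs) a b =
  cong₂ _+_ (cong (λ β → χ β * p x a b) (⌊≟⌋-≢ (All.lookup x≢xs i∈xs)))
            (⨁-δ p unique i∈xs a b)

inRange : ℕ → ℕ → ℕ → ℕ
inRange lo zero    j = 0
inRange lo (suc r) j = χ ⌊ j ≟ lo ⌋ + inRange (suc lo) r j

inRange-below : ∀ lo r j → j < lo → inRange lo r j ≡ 0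
inRange-below lo zero    j j<lo = refl
inRange-below lo (suc r) j j<lo =
  cong₂ _+_ (cong χ (⌊≟⌋-≢ (<⇒≢ j<lo))) (inRange-below (suc lo) r j (m<n⇒m<1+n j<lo))

inRange-above : ∀ lo r j → lo + r ≤ j → inRange lo r j ≡ 0
inRange-above lo zero    j _       = refl
inRange-above lo (suc r) j lo+r≤j =
  cong₂ _+_ (cong χ (⌊≟⌋-≢ (≢-sym (<⇒≢ lo<j))))
            (inRange-above (suc lo) r j (subst (_≤ j) (+-suc lo r) lo+r≤j))
  where
  lo<j : lo < j
  lo<j = <-≤-trans (m<m+n lo z<s) lo+r≤j

inRange-within : ∀ lo r j → lo ≤ j → j < lo + r → inRange lo r j ≡ 1
inRange-within lo zero    j lo≤j j<lo+0 =
  contradiction (subst (j <_) (+-identityʳ lo) j<lo+0) (≤⇒≯ lo≤j)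
inRange-within lo (suc r) j lo≤j j<lo+r with j ≟ lo
... | yes refl = cong suc (inRange-below (suc j) r j (n<1+n j))
... | no  j≢lo =
  inRange-within (suc lo) r j (≤∧≢⇒< lo≤j (≢-sym j≢lo)) (subst (j <_) (+-suc lo r) j<lo+r)

inRange-split : ∀ c r j (p : Poly) → j < c + r →
  (mulX (inRange 0 c j · p) ⊕ inRange c r j · p) ≐ mulXif ⌊ j <? c ⌋ p
inRange-split c r j p j<c+r with j <? c
... | yes j<c rewrite inRange-within 0 c j z≤n j<c | inRange-below c r j j<c = λ where
  a zero    → refl
  a (suc b) → trans (+-identityʳ _) (*-identityˡ _)
... | no  j≮c rewrite inRange-above 0 c j (≮⇒≥ j≮c)
                     | inRange-within c r j (≮⇒≥ j≮c) j<c+r = λ where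
  a zero    → *-identityˡ _
  a (suc b) → *-identityˡ _

lastOr0-snoc : ∀ e k → lastOr0 (e ++ [ k ]) ≡ k
lastOr0-snoc []           k = refl
lastOr0-snoc (a ∷ [])     k = refl
lastOr0-snoc (a ∷ b ∷ bs) k = lastOr0-snoc (b ∷ bs) k

excFrom-snoc : ∀ s e k → excFrom s (e ++ [ k ]) ≡ χ ⌊ s + length e ≤? k ⌋ + excFrom s e
excFrom-snoc s []       k rewrite +-identityʳ s = refl
excFrom-snoc s (a ∷ es) k rewrite excFrom-snoc (suc s) es k | +-suc s (length es) =
  x∙yz≈y∙xz (χ ⌊ s ≤? a ⌋) (χ ⌊ suc (s + length es) ≤? k ⌋) (excFrom (suc s) es)

ascFrom-snoc : ∀ s x es k →
  ascFrom s (x ∷ es ++ [ k ]) ≡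
  χ ⌊ lastOr0 (x ∷ es) * suc (s + length es) <? k * (s + length es) ⌋ + ascFrom s (x ∷ es)
ascFrom-snoc s x []       k rewrite +-identityʳ s = refl
ascFrom-snoc s x (y ∷ ys) k rewrite ascFrom-snoc (suc s) y ys k | +-suc s (length ys) =
  x∙yz≈y∙xz (χ ⌊ x * suc s <? y * s ⌋) ascent (ascFrom (suc s) (y ∷ ys))
  where
  ascent : ℕ
  ascent = χ ⌊ lastOr0 (y ∷ ys) * suc (suc (s + length ys)) <? k * suc (s + length ys) ⌋

exc-snoc : ∀ e k → exc (e ++ [ k ]) ≡ χ ⌊ suc (length e) ≤? k ⌋ + exc e
exc-snoc = excFrom-snoc 1

ascD-snoc : ∀ x y es k → let e = x ∷ y ∷ es in
  ascD (e ++ [ k ]) ≡ χ ⌊ lastOr0 e * suc (length e) <? k * length e ⌋ + ascD e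
ascD-snoc x y es k =
  trans (cong (asc0 e +_) (ascFrom-snoc 1 x (y ∷ es) k)) (x∙yz≈y∙xz (asc0 e) ascent (ascFrom 1 e))
  where
  e : List ℕ
  e = x ∷ y ∷ es
  ascent : ℕ
  ascent = χ ⌊ lastOr0 e * suc (length e) <? k * length e ⌋

All-I-suc : ∀ {P Q : List ℕ → Set} n → All P (I n) →
  (∀ {e k} → P e → k < 2 * suc n → Q (e ++ [ k ])) → All Q (I (suc n))
All-I-suc n all-P P⇒Q =
  concat⁺ (map⁺ (All.map (λ Pe → map⁺ (applyUpTo⁺₁ (λ k → k) (2 * suc n) (P⇒Q Pe))) all-P))

length-I : ∀ n → All (λ e → length e ≡ n) (I n)
length-I zero    = refl ∷ []
length-I (suc n) = All-I-suc n (length-I n) λ {e} len _ →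
  trans (length-++ e) (trans (cong (_+ 1) len) (+-comm n 1))

lastOr0-I : ∀ n → All (λ e → lastOr0 e < 2 * suc n) (I (suc n))
lastOr0-I n = All-I-suc n (universal (λ _ → tt) (I n)) λ {e} {k} _ k< →
  subst (_< 2 * suc n) (sym (lastOr0-snoc e k)) k<

weight : List ℕ → Poly
weight e = mono (exc e) (ascD e)

T-⨁ : ∀ n i → T n i ≐ ⨁ (I n) (λ e → χ ⌊ lastOr0 e ≟ i ⌋ · weight e)
T-⨁ n i a b = cong sum (map-cong term (I n))
  where
  term : ∀ e → χ (⌊ lastOr0 e ≟ i ⌋ ∧ ⌊ exc e ≟ a ⌋ ∧ ⌊ ascD e ≟ b ⌋)
             ≡ (χ ⌊ lastOr0 e ≟ i ⌋ · weight e) a b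
  term e = trans (χ-∧ ⌊ lastOr0 e ≟ i ⌋ _)
                 (cong (χ ⌊ lastOr0 e ≟ i ⌋ *_) (mono-≟-comm (exc e) (ascD e) a b))

Tall-⨁ : ∀ n → Tall n ≐ ⨁ (I n) weight
Tall-⨁ n a b = cong sum (map-cong (λ e → mono-≟-comm (exc e) (ascD e) a b) (I n))

ΣP-T : ∀ n lo r → ΣP lo r (T n) ≐ ⨁ (I n) (λ e → inRange lo r (lastOr0 e) · weight e)
ΣP-T n lo zero    = ≐-sym (⨁-zero (universal (λ _ → ≐-refl) (I n)))
ΣP-T n lo (suc r) = begin
  (T n lo ⊕ ΣP (suc lo) r (T n))
    ≈⟨ ⊕-cong (T-⨁ n lo) (ΣP-T n (suc lo) r) ⟩
  (⨁ (I n) (λ e → at-lo e · weight e) ⊕ ⨁ (I n) (λ e → above-lo e · weight e))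
    ≈⟨ ⨁-⊕ (I n) _ _ ⟩
  ⨁ (I n) (λ e → at-lo e · weight e ⊕ above-lo e · weight e)
    ≈⟨ ⨁-cong (universal distrib (I n)) ⟨
  ⨁ (I n) (λ e → inRange lo (suc r) (lastOr0 e) · weight e) ∎
  where
  open ≐-Reasoning
  at-lo above-lo : List ℕ → ℕ
  at-lo e = χ ⌊ lastOr0 e ≟ lo ⌋
  above-lo e = inRange (suc lo) r (lastOr0 e)
  distrib : ∀ e → (at-lo e + above-lo e) · weight e ≐ (at-lo e · weight e ⊕ above-lo e · weight e)
  distrib e = ·-distribʳ-+ (at-lo e) (above-lo e) (weight e)

ΣP-T-split : ∀ n c r → All (λ e → lastOr0 e < c + r) (I n) →
  (mulX (ΣP 0 c (T n)) ⊕ ΣP c r (T n)) ≐ ⨁ (I n) (λ e → mulXif ⌊ lastOr0 e <? c ⌋ (weight e))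
ΣP-T-split n c r last< = begin
  (mulX (ΣP 0 c (T n)) ⊕ ΣP c r (T n))              ≈⟨ ⊕-cong (mulX-cong (ΣP-T n 0 c)) (ΣP-T n c r) ⟩
  (mulX (⨁ (I n) lower) ⊕ ⨁ (I n) upper)            ≈⟨ ⊕-cong (⨁-mulX (I n) lower) ≐-refl ⟩
  (⨁ (I n) (λ e → mulX (lower e)) ⊕ ⨁ (I n) upper)  ≈⟨ ⨁-⊕ (I n) _ upper ⟩
  ⨁ (I n) (λ e → mulX (lower e) ⊕ upper e)          ≈⟨ ⨁-cong (All.map (λ {e} → split {e}) last<) ⟩
  ⨁ (I n) (λ e → mulXif ⌊ lastOr0 e <? c ⌋ (weight e)) ∎
  where
  open ≐-Reasoning
  lower upper : List ℕ → Poly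
  lower e = inRange 0 c (lastOr0 e) · weight e
  upper e = inRange c r (lastOr0 e) · weight e
  split : ∀ {e} → lastOr0 e < c + r →
    (mulX (lower e) ⊕ upper e) ≐ mulXif ⌊ lastOr0 e <? c ⌋ (weight e)
  split {e} = inRange-split c r (lastOr0 e) (weight e)

weight-snoc : ∀ {n} e k → length e ≡ n → 2 ≤ n →
  weight (e ++ [ k ]) ≐ mulQif ⌊ suc n ≤? k ⌋ (mulXif ⌊ lastOr0 e * suc n <? k * n ⌋ (weight e))
weight-snoc []           k refl ()
weight-snoc (x ∷ [])     k refl (s≤s ())
weight-snoc (x ∷ y ∷ es) k refl _ = begin
  mono (exc (e ++ [ k ])) (ascD (e ++ [ k ]))
    ≡⟨ cong₂ mono (exc-snoc e k) (ascD-snoc x y es k) ⟩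
  mono (χ excedance + exc e) (χ ascent + ascD e)
    ≈⟨ mulQif-mono excedance (exc e) _ ⟨
  mulQif excedance (mono (exc e) (χ ascent + ascD e))
    ≈⟨ mulQif-cong excedance (mulXif-mono ascent (exc e) (ascD e)) ⟨
  mulQif excedance (mulXif ascent (weight e)) ∎
  where
  open ≐-Reasoning
  e : List ℕ
  e = x ∷ y ∷ es
  excedance ascent : Bool
  excedance = ⌊ suc (length e) ≤? k ⌋
  ascent = ⌊ lastOr0 e * suc (length e) <? k * length e ⌋

⨁-extensions-ending-in : ∀ e i M (p : List ℕ → Poly) → i < M →
  ⨁ (map (λ k → e ++ [ k ]) (upTo M)) (λ e′ → χ ⌊ lastOr0 e′ ≟ i ⌋ · p e′) ≐ p (e ++ [ i ])
⨁-extensions-ending-in e i M p i<M = begin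
  ⨁ (map (λ k → e ++ [ k ]) (upTo M)) (λ e′ → χ ⌊ lastOr0 e′ ≟ i ⌋ · p e′)
    ≈⟨ ⨁-map (λ k → e ++ [ k ]) (upTo M) _ ⟩
  ⨁ (upTo M) (λ k → χ ⌊ lastOr0 (e ++ [ k ]) ≟ i ⌋ · p (e ++ [ k ]))
    ≈⟨ ⨁-cong (universal last-is-k (upTo M)) ⟩
  ⨁ (upTo M) (λ k → χ ⌊ k ≟ i ⌋ · p (e ++ [ k ]))
    ≈⟨ ⨁-δ (λ k → p (e ++ [ k ])) (upTo⁺ M) (∈-upTo⁺ i<M) ⟩
  p (e ++ [ i ]) ∎
  where
  open ≐-Reasoning
  last-is-k : ∀ k → χ ⌊ lastOr0 (e ++ [ k ]) ≟ i ⌋ · p (e ++ [ k ]) ≐ χ ⌊ k ≟ i ⌋ · p (e ++ [ k ])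
  last-is-k k a b = cong (λ j → χ ⌊ j ≟ i ⌋ * p (e ++ [ k ]) a b) (lastOr0-snoc e k)

T-snoc : ∀ n i → 2 ≤ n → i < 2 * suc n →
  T (suc n) i ≐ ⨁ (I n) (λ e → mulQif ⌊ suc n ≤? i ⌋ (mulXif ⌊ lastOr0 e * suc n <? i * n ⌋ (weight e)))
T-snoc n i 2≤n i<2n = begin
  T (suc n) i                                           ≈⟨ T-⨁ (suc n) i ⟩
  ⨁ (I (suc n)) (λ e → χ ⌊ lastOr0 e ≟ i ⌋ · weight e)  ≈⟨ ⨁-concatMap extensions (I n) _ ⟩
  ⨁ (I n) (λ e → ⨁ (extensions e) (λ e′ → χ ⌊ lastOr0 e′ ≟ i ⌋ · weight e′))
    ≈⟨ ⨁-cong (All.map (λ {e} → extend-by-i e) (length-I n)) ⟩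
  ⨁ (I n) (λ e → mulQif ⌊ suc n ≤? i ⌋ (mulXif ⌊ lastOr0 e * suc n <? i * n ⌋ (weight e))) ∎
  where
  open ≐-Reasoning
  extensions : List ℕ → List (List ℕ)
  extensions e = map (λ k → e ++ [ k ]) (upTo (2 * suc n))
  extend-by-i : ∀ e → length e ≡ n →
    ⨁ (extensions e) (λ e′ → χ ⌊ lastOr0 e′ ≟ i ⌋ · weight e′)
      ≐ mulQif ⌊ suc n ≤? i ⌋ (mulXif ⌊ lastOr0 e * suc n <? i * n ⌋ (weight e))
  extend-by-i e len = ≐-trans (⨁-extensions-ending-in e i _ weight i<2n) (weight-snoc e i len 2≤n)

T-recurrence : (n i : ℕ) → 3 ≤ n → i ≤ 2 * n ∸ 1 →
  T n i ≐ mulQif (n ≤ᵇ i)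
            (mulX (ΣP 0 (ceilDiv ((n ∸ 1) * i) n) (T (n ∸ 1)))
             ⊕ ΣP (ceilDiv ((n ∸ 1) * i) n) ((2 * n ∸ 2) ∸ ceilDiv ((n ∸ 1) * i) n) (T (n ∸ 1)))
T-recurrence (suc n@(suc (suc m))) i (s≤s 2≤n@(s≤s (s≤s z≤n))) i≤ = begin
  T (suc n) i
    ≈⟨ T-snoc n i 2≤n (s≤s i≤) ⟩
  ⨁ (I n) (λ e → mulQif ⌊ suc n ≤? i ⌋ (mulXif ⌊ lastOr0 e * suc n <? i * n ⌋ (weight e)))
    ≈⟨ ⨁-cong (universal ceiling-threshold (I n)) ⟩
  ⨁ (I n) (λ e → mulQif (suc n ≤ᵇ i) (mulXif ⌊ lastOr0 e <? c ⌋ (weight e)))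
    ≈⟨ ⨁-mulQif (suc n ≤ᵇ i) (I n) _ ⟨
  mulQif (suc n ≤ᵇ i) (⨁ (I n) (λ e → mulXif ⌊ lastOr0 e <? c ⌋ (weight e)))
    ≈⟨ mulQif-cong (suc n ≤ᵇ i) (ΣP-T-split n c r last<c+r) ⟨
  mulQif (suc n ≤ᵇ i) (mulX (ΣP 0 c (T n)) ⊕ ΣP c r (T n)) ∎
  where
  open ≐-Reasoning
  c r : ℕ
  c = ceilDiv (n * i) (suc n)
  r = (2 * suc n ∸ 2) ∸ c
  ascent⇔below-c : ∀ j → ⌊ j * suc n <? i * n ⌋ ≡ ⌊ j <? c ⌋
  ascent⇔below-c j = trans (cong (λ k → ⌊ j * suc n <? k ⌋) (*-comm i n)) (⌊<?⌋-ceilDiv j (n * i) n)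
  2n≤c+r : 2 * n ≤ c + r
  2n≤c+r = ≤-trans (≤-reflexive (*-distribˡ-∸ 2 (suc n) 1)) (m≤n+m∸n (2 * suc n ∸ 2) c)
  ceiling-threshold : ∀ e →
    mulQif ⌊ suc n ≤? i ⌋ (mulXif ⌊ lastOr0 e * suc n <? i * n ⌋ (weight e))
      ≐ mulQif (suc n ≤ᵇ i) (mulXif ⌊ lastOr0 e <? c ⌋ (weight e))
  ceiling-threshold e = ≐-reflexive (cong₂ (λ β γ → mulQif β (mulXif γ (weight e)))
                                           (isYes≗does (suc n ≤? i)) (ascent⇔below-c (lastOr0 e)))
  last<c+r : All (λ e → lastOr0 e < c + r) (I n)
  last<c+r = All.map (λ last< → <-≤-trans last< 2n≤c+r) (lastOr0-I (suc m))

-- For i = 0 both the excedance and the ascent test of T-snoc fail by computation.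
T-last-zero : (n : ℕ) → 3 ≤ n → T n 0 ≐ Tall (n ∸ 1)
T-last-zero (suc n) (s≤s 2≤n) = ≐-trans (T-snoc n 0 2≤n z<s) (≐-sym (Tall-⨁ n))

lemma3p3 : ((n i : ℕ) → 3 ≤ n → i ≤ 2 * n ∸ 1 →
              T n i ≐ mulQif (n ≤ᵇ i)
                        (mulX (ΣP 0 (ceilDiv ((n ∸ 1) * i) n) (T (n ∸ 1)))
                         ⊕ ΣP (ceilDiv ((n ∸ 1) * i) n)
                              ((2 * n ∸ 2) ∸ ceilDiv ((n ∸ 1) * i) n) (T (n ∸ 1))))
           × (T 2 0 ≐ (mono 0 0 ⊕ mono 1 0))
           × (T 2 1 ≐ (mono 0 1 ⊕ mono 1 1))
           × (T 2 2 ≐ (mono 1 1 ⊕ mono 2 1))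
           × (T 2 3 ≐ (mono 1 2 ⊕ mono 2 2))
           × ((n : ℕ) → 3 ≤ n → T n 0 ≐ Tall (n ∸ 1))
lemma3p3 = T-recurrence
         , ≐-two-monos (T 2 0) 0 0 1 0 (λ _ _ → refl)
         , ≐-two-monos (T 2 1) 0 1 1 1 (λ _ _ → refl)
         , ≐-two-monos (T 2 2) 1 1 2 1 (λ _ _ → refl)
         , ≐-two-monos (T 2 3) 1 2 2 2 (λ _ _ → refl)
         , T-last-zero
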